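{- Let $a,b\in\mathbb{N}$ satisfy $\gcd(a,b)=1$, $b\ge 2$, and $a$ odd. Consider the two equations \begin{align*} ax + by \ &= \ \frac{(a+1)b}{2} + 1, \\ ax + by \ &= \ \frac{(a+1)b}{2} - 1. \end{align*} Exactly one of these two equations has a solution $(x,y)$ with $x,y$ positive integers, and that positive integral solution is unique. -}

module Defs where

open import Data.Nat using (ℕ; _+_; _*_; _∸_; _<_; _/_)
open import Data.Product using (Σ; ∃; _×_)
open import Relation.Binary.PropositionalEquality using (_≡_)
open import Relation.Nullary using (¬_)

PosSol : ℕ → ℕ → ℕ → ℕ → ℕ → Set
PosSol a b c x y = 0 < x × 0 < y × a * x + b * y ≡ c

HasPosSol : ℕ → ℕ → ℕ → Set
HasPosSol a b c = Σ ℕ λ x → Σ ℕ λ y → PosSol a b c x y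

HasUniquePosSol : ℕ → ℕ → ℕ → Set
HasUniquePosSol a b c =
  Σ ℕ λ x → Σ ℕ λ y → PosSol a b c x y ×
    (∀ x′ y′ → PosSol a b c x′ y′ → x′ ≡ x × y′ ≡ y)

-- (a+1) b / 2  (an exact natural number when a is odd)
half : ℕ → ℕ → ℕ
half a b = ((a + 1) * b) / 2

-- Write a = 2k + 1, so that N = (a + 1) b / 2 = (k + 1) b.  Since a is invertible
-- modulo b, there are u < b and m with a u = 1 + m b.  If m ≤ k then
-- (u , k − m + 1) solves a x + b y = N + 1; otherwise (b − u , m − k) solves
-- a x + b y = N − 1.  Both cannot be solvable: adding the solutions gives
-- a X + b Y = (a + 1) b with Y ≥ 2, hence b ∣ X, so a X ≥ a b and then Y ≤ 1.
-- Two positive solutions of a x + b y = c differ in x by a nonzero multiple of b,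
-- which forces c ≥ a (b + 1) + b; both N ± 1 lie below that bound.
module Submission where

open import Defs
open import Data.List using (_∷_; [])
open import Data.Nat using (ℕ; zero; suc; _+_; _*_; _∸_; _≤_; _<_; _%_; _/_; z<s; NonZero; >-nonZero)
open import Data.Nat.Coprimality using (Coprime; gcd≡1⇒coprime; coprime-Bézout; coprime-divisor)
import Data.Nat.Coprimality as Coprime
open import Data.Nat.DivMod
  using (m≡m%n+[m/n]*n; [m+kn]%n≡m%n; m<n⇒m%n≡m; m%n<n; m%n%n≡m%n; %-distribˡ-*; m*n/n≡m)
open import Data.Nat.Divisibility using (_∣_; ∣⇒≤; ∣m+n∣m⇒∣n; m∣m*n; n∣m*n)
open import Data.Nat.GCD using (gcd; module Bézout)
open import Data.Nat.Properties
open import Data.Nat.Tactic.RingSolver using (solve-∀; solve)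
open import Data.Product using (_×_; _,_; ∃-syntax; ∃₂)
open import Data.Sum using (_⊎_; inj₁; inj₂; [_,_]′)
open import Function using (_∘_)
open import Relation.Binary.PropositionalEquality
open import Relation.Nullary using (¬_; contradiction)

ExactlyOneSolvable : ℕ → ℕ → ℕ → ℕ → Set
ExactlyOneSolvable a b c c′ =
  (HasUniquePosSol a b c × ¬ HasPosSol a b c′) ⊎ (¬ HasPosSol a b c × HasUniquePosSol a b c′)

m*n≡1+o⇒0<n : ∀ m {n o} → m * n ≡ suc o → 0 < n
m*n≡1+o⇒0<n m eq = n≢0⇒n>0 λ { refl → 0≢1+n (trans (sym (*-zeroʳ m)) eq) }

∣∧<⇒≡0 : ∀ {b d} → b ∣ d → d < b → d ≡ 0
∣∧<⇒≡0 {d = zero}  _   _   = refl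
∣∧<⇒≡0 {d = suc _} b∣d d<b = contradiction (∣⇒≤ b∣d) (<⇒≱ d<b)

[1+a]*b<a*[1+b]+b : ∀ {a} b → 0 < a → suc a * b < a * suc b + b
[1+a]*b<a*[1+b]+b {suc a₀} b _ = subst (suc (suc a₀) * b <_) (identity a₀ b) (m<m+n _ z<s)
  where
  identity : ∀ a₀ b → suc (suc a₀) * b + suc a₀ ≡ suc a₀ * suc b + b
  identity = solve-∀

coprime-inverse : ∀ {a b} .{{_ : NonZero b}} → Coprime a b → 1 < b → ∃[ x ] a * x % b ≡ 1
coprime-inverse {a} {b@(suc b₀)} a⊥b 1<b with coprime-Bézout a⊥b
... | Bézout.+- x y 1+yb≡xa = x , (begin
  a * x % b          ≡⟨ cong (_% b) (trans (*-comm a x) (sym 1+yb≡xa)) ⟩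
  (1 + y * b) % b    ≡⟨ [m+kn]%n≡m%n 1 y b ⟩
  1 % b              ≡⟨ m<n⇒m%n≡m 1<b ⟩
  1                  ∎)
  where open ≡-Reasoning
... | Bézout.-+ x y 1+xa≡yb = x * b₀ , (begin
  a * (x * b₀) % b                  ≡⟨ sym ([m+kn]%n≡m%n (a * (x * b₀)) y b) ⟩
  (a * (x * b₀) + y * b) % b        ≡⟨ cong (λ z → (a * (x * b₀) + z) % b) (sym 1+xa≡yb) ⟩
  (a * (x * b₀) + (1 + x * a)) % b  ≡⟨ cong (_% b) a[xb₀]+1+xa≡1+axb ⟩
  (1 + a * x * b) % b               ≡⟨ [m+kn]%n≡m%n 1 (a * x) b ⟩
  1 % b                             ≡⟨ m<n⇒m%n≡m 1<b ⟩
  1                                 ∎)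
  where
  open ≡-Reasoning
  a[xb₀]+1+xa≡1+axb : a * (x * b₀) + (1 + x * a) ≡ 1 + a * x * b
  a[xb₀]+1+xa≡1+axb = solve (a ∷ x ∷ b₀ ∷ [])

coprime-reduced-inverse : ∀ {a b} → Coprime a b → 1 < b → ∃₂ λ u m → u < b × a * u ≡ 1 + m * b
coprime-reduced-inverse {a} {b@(suc _)} a⊥b 1<b with x , ax%b≡1 ← coprime-inverse a⊥b 1<b =
  x % b , a * (x % b) / b , m%n<n x b ,
  trans (m≡m%n+[m/n]*n (a * (x % b)) b) (cong (_+ a * (x % b) / b * b) (trans a[x%b]%b≡ax%b ax%b≡1))
  where
  a[x%b]%b≡ax%b : a * (x % b) % b ≡ a * x % b
  a[x%b]%b≡ax%b = begin
    a * (x % b) % b              ≡⟨ %-distribˡ-* a (x % b) b ⟩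
    (a % b) * (x % b % b) % b    ≡⟨ cong (λ z → (a % b) * z % b) (m%n%n≡m%n x b) ⟩
    (a % b) * (x % b) % b        ≡⟨ %-distribˡ-* a x b ⟨
    a * x % b                    ∎
    where open ≡-Reasoning

module _ {a b : ℕ} .{{_ : NonZero b}} (a⊥b : Coprime a b) where

  b∣a*x⇒b∣x : ∀ {x} → b ∣ a * x → b ∣ x
  b∣a*x⇒b∣x = coprime-divisor (Coprime.sym a⊥b)

  posSol-≤⇒≡ : ∀ {c x y x′ y′} → c < a * suc b + b →
               PosSol a b c x y → PosSol a b c x′ y′ → x ≤ x′ → x ≡ x′
  posSol-≤⇒≡ {c} {x} {y} {y′ = y′} c<bound (0<x , _ , eq) (_ , 0<y′ , eq′) x≤x′
    with d , refl ← m≤n⇒∃[o]m+o≡n x≤x′ =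
    sym (trans (cong (x +_) (∣∧<⇒≡0 (b∣a*x⇒b∣x b∣ad) d<b)) (+-identityʳ x))
    where
    by≡by′+ad : b * y ≡ b * y′ + a * d
    by≡by′+ad = +-cancelˡ-≡ (a * x) _ _
      (trans eq (trans (sym eq′) (solve (a ∷ x ∷ d ∷ b ∷ y′ ∷ []))))
    b∣ad : b ∣ a * d
    b∣ad = ∣m+n∣m⇒∣n (subst (b ∣_) by≡by′+ad (m∣m*n y)) (m∣m*n y′)
    d<b : d < b
    d<b = ≰⇒> λ b≤d → contradiction c<bound (≤⇒≯ (begin
      a * suc b + b        ≤⟨ +-mono-≤ (*-monoʳ-≤ a (+-mono-≤ 0<x b≤d)) (m≤m*n b y′ {{>-nonZero 0<y′}}) ⟩
      a * (x + d) + b * y′ ≡⟨ eq′ ⟩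
      c                    ∎))
      where open ≤-Reasoning

  posSol-unique : ∀ {c x y x′ y′} → c < a * suc b + b →
                  PosSol a b c x y → PosSol a b c x′ y′ → x ≡ x′ × y ≡ y′
  posSol-unique {x = x} {y} {x′} {y′} c<bound s@(_ , _ , eq) s′@(_ , _ , eq′) = x≡x′ , y≡y′
    where
    x≡x′ : x ≡ x′
    x≡x′ = [ posSol-≤⇒≡ c<bound s s′ , sym ∘ posSol-≤⇒≡ c<bound s′ s ]′ (≤-total x x′)
    y≡y′ : y ≡ y′
    y≡y′ = *-cancelˡ-≡ y y′ b (+-cancelˡ-≡ (a * x′) _ _
      (trans (cong (λ z → a * z + b * y) (sym x≡x′)) (trans eq (sym eq′))))

  ¬complementary-posSols : ∀ {c c′} → c + c′ ≡ suc a * b → ¬ (HasPosSol a b c × HasPosSol a b c′)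
  ¬complementary-posSols {c} {c′} c+c′≡[1+a]b ((x , y , 0<x , 0<y , eq) , (x′ , y′ , _ , 0<y′ , eq′)) =
    <-irrefl refl (≤-trans (+-mono-≤ 0<y 0<y′) y+y′≤1)
    where
    sum : b * (y + y′) + a * (x + x′) ≡ suc a * b
    sum = begin
      b * (y + y′) + a * (x + x′)      ≡⟨ solve (a ∷ b ∷ x ∷ y ∷ x′ ∷ y′ ∷ []) ⟩
      (a * x + b * y) + (a * x′ + b * y′) ≡⟨ cong₂ _+_ eq eq′ ⟩
      c + c′                            ≡⟨ c+c′≡[1+a]b ⟩
      suc a * b                         ∎
      where open ≡-Reasoning
    b∣x+x′ : b ∣ x + x′
    b∣x+x′ = b∣a*x⇒b∣x (∣m+n∣m⇒∣n (subst (b ∣_) (sym sum) (n∣m*n (suc a))) (m∣m*n (y + y′)))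
    y+y′≤1 : y + y′ ≤ 1
    y+y′≤1 = *-cancelˡ-≤ b (+-cancelʳ-≤ (a * b) _ _ (begin
      b * (y + y′) + a * b        ≤⟨ +-monoʳ-≤ (b * (y + y′)) (*-monoʳ-≤ a (∣⇒≤ {{nonZero}} b∣x+x′)) ⟩
      b * (y + y′) + a * (x + x′) ≡⟨ sum ⟩
      b + a * b                   ≡⟨ cong (_+ a * b) (*-identityʳ b) ⟨
      b * 1 + a * b               ∎))
      where
      open ≤-Reasoning
      nonZero : NonZero (x + x′)
      nonZero = >-nonZero (≤-trans 0<x (m≤m+n x x′))

  hasPosSol⇒hasUniquePosSol : ∀ {c} → c < a * suc b + b → HasPosSol a b c → HasUniquePosSol a b c
  hasPosSol⇒hasUniquePosSol c<bound (x , y , s) = x , y , s , λ x′ y′ s′ → posSol-unique c<bound s′ s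

  exactlyOneSolvable : ∀ {c c′} → 0 < a → c + c′ ≡ suc a * b →
                       HasPosSol a b c ⊎ HasPosSol a b c′ → ExactlyOneSolvable a b c c′
  exactlyOneSolvable {c} {c′} 0<a c+c′≡[1+a]b =
    [ (λ s  → inj₁ (hasPosSol⇒hasUniquePosSol c<bound s , λ s′ → ¬both (s , s′)))
    , (λ s′ → inj₂ ((λ s → ¬both (s , s′)) , hasPosSol⇒hasUniquePosSol c′<bound s′)) ]′
    where
    ¬both : ¬ (HasPosSol a b c × HasPosSol a b c′)
    ¬both = ¬complementary-posSols c+c′≡[1+a]b
    c<bound : c < a * suc b + b
    c<bound = ≤-<-trans (≤-trans (m≤m+n c c′) (≤-reflexive c+c′≡[1+a]b)) ([1+a]*b<a*[1+b]+b b 0<a)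
    c′<bound : c′ < a * suc b + b
    c′<bound = ≤-<-trans (≤-trans (m≤n+m c′ c) (≤-reflexive c+c′≡[1+a]b)) ([1+a]*b<a*[1+b]+b b 0<a)

inverse⇒solution-above : ∀ a b {u m} t → a * u ≡ 1 + m * b → a * u + b * suc t ≡ suc (m + t) * b + 1
inverse⇒solution-above a b {u} {m} t au≡1+mb = begin
  a * u + b * suc t         ≡⟨ cong (_+ b * suc t) au≡1+mb ⟩
  1 + m * b + b * suc t     ≡⟨ solve (m ∷ t ∷ b ∷ []) ⟩
  suc (m + t) * b + 1       ∎
  where open ≡-Reasoning

-- With a = 2k + 1, m = k + 1 + t and b = u + 1 + w, the point (w + 1 , t + 1)
-- is (b − u , m − k).
inverse⇒solution-below : ∀ k t u w →
  suc (k + k) * u ≡ 1 + (suc k + t) * (suc u + w) →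
  suc (k + k) * suc w + (suc u + w) * suc t + 1 ≡ suc k * (suc u + w)
inverse⇒solution-below k t u w au≡1+mb = +-cancelʳ-≡ (m * b) _ _ (begin
  a * suc w + b * suc t + 1 + m * b   ≡⟨ +-assoc (a * suc w + b * suc t) 1 (m * b) ⟩
  a * suc w + b * suc t + (1 + m * b) ≡⟨ cong (a * suc w + b * suc t +_) au≡1+mb ⟨
  a * suc w + b * suc t + a * u       ≡⟨ identity k t u w ⟩
  suc k * b + m * b                   ∎)
  where
  open ≡-Reasoning
  a = suc (k + k)
  b = suc u + w
  m = suc k + t
  identity : ∀ k t u w → let a = suc (k + k); b = suc u + w in
             a * suc w + b * suc t + a * u ≡ suc k * b + (suc k + t) * b
  identity = solve-∀

hasPosSol-N+1⊎N∸1 : ∀ k {b} → Coprime (suc (k + k)) b → 1 < b →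
  HasPosSol (suc (k + k)) b (suc k * b + 1) ⊎ HasPosSol (suc (k + k)) b (suc k * b ∸ 1)
hasPosSol-N+1⊎N∸1 k {b} a⊥b 1<b with u , m , u<b , au≡1+mb ← coprime-reduced-inverse a⊥b 1<b
                                  with ≤-<-connex m k
... | inj₁ m≤k with t , refl ← m≤n⇒∃[o]m+o≡n m≤k =
  inj₁ (u , suc t , m*n≡1+o⇒0<n (suc (k + k)) au≡1+mb , z<s ,
        inverse⇒solution-above (suc (k + k)) b {u} {m} t au≡1+mb)
... | inj₂ k<m with t , refl ← m≤n⇒∃[o]m+o≡n k<m | w , refl ← m≤n⇒∃[o]m+o≡n u<b =
  inj₂ (suc w , suc t , z<s , z<s ,
        trans (sym (m+n∸n≡m _ 1)) (cong (_∸ 1) (inverse⇒solution-below k t u w au≡1+mb)))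

n%2≡1⇒∃[k]1+k+k≡n : ∀ {n} → n % 2 ≡ 1 → ∃[ k ] suc (k + k) ≡ n
n%2≡1⇒∃[k]1+k+k≡n {n} n%2≡1 = n / 2 , (begin
  suc (n / 2 + n / 2)  ≡⟨ cong suc (n+n≡n*2 (n / 2)) ⟩
  1 + n / 2 * 2        ≡⟨ cong (_+ n / 2 * 2) n%2≡1 ⟨
  n % 2 + n / 2 * 2    ≡⟨ m≡m%n+[m/n]*n n 2 ⟨
  n                    ∎)
  where
  open ≡-Reasoning
  n+n≡n*2 : ∀ n → n + n ≡ n * 2
  n+n≡n*2 = solve-∀

half-odd : ∀ k b → half (suc (k + k)) b ≡ suc k * b
half-odd k b = trans (cong (_/ 2) ([1+a]*b≡[1+k]*b*2 k b)) (m*n/n≡m (suc k * b) 2)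
  where
  [1+a]*b≡[1+k]*b*2 : ∀ k b → (suc (k + k) + 1) * b ≡ suc k * b * 2
  [1+a]*b≡[1+k]*b*2 = solve-∀

N+1+[N∸1]≡[1+a]*b : ∀ k b₀ → (suc k * suc b₀ + 1) + (suc k * suc b₀ ∸ 1) ≡ suc (suc (k + k)) * suc b₀
N+1+[N∸1]≡[1+a]*b k b₀ = identity k b₀
  where
  -- stated on the normal forms of (k + 1) (b₀ + 1) ± 1, as the solver does not handle ∸
  identity : ∀ k b₀ → (suc (b₀ + k * suc b₀) + 1) + (b₀ + k * suc b₀) ≡ suc (suc (k + k)) * suc b₀
  identity = solve-∀

theorem4p2 : (a b : ℕ) → gcd a b ≡ 1 → 2 ≤ b → a % 2 ≡ 1 →
    (HasUniquePosSol a b (half a b + 1) × ¬ HasPosSol a b (half a b ∸ 1))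
    ⊎ (¬ HasPosSol a b (half a b + 1) × HasUniquePosSol a b (half a b ∸ 1))
theorem4p2 a zero _ ()
theorem4p2 a b@(suc b₀) gcd≡1 1<b a%2≡1 with k , refl ← n%2≡1⇒∃[k]1+k+k≡n {a} a%2≡1
  rewrite half-odd k b =
  let a⊥b = gcd≡1⇒coprime gcd≡1 in
  exactlyOneSolvable a⊥b z<s (N+1+[N∸1]≡[1+a]*b k b₀) (hasPosSol-N+1⊎N∸1 k a⊥b 1<b)
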